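{- Let $G$ be a finite simple connected graph, let $k\ge 0$ be an integer, and let $H$ be a convex subgraph of $G$. Then $\mu_k(H)\le \mu_k(G)$.
   Context: A subgraph $H$ of $G$ is convex if for every pair of vertices $u,v\in V(H)$, every shortest $(u,v)$-path in $G$ is entirely contained in $H$. For a graph $F$, $X\subseteq V(F)$ and an integer $k\ge 0$, two vertices $u,v\in V(F)$ are called $(X,k)$-visible in $F$ if there exists a shortest $(u,v)$-path in $F$ having at most $k$ internal vertices that lie in $X$. A set $X\subseteq V(F)$ is a mutual $k$-visible set in $F$ if every pair of distinct vertices of $X$ is $(X,k)$-visible in $F$. The mutual $k$-visibility number $\mu_k(F)$ is the maximum cardinality of a mutual $k$-visible set in $F$. -}

module Defs where

open import Data.Nat using (ℕ; zero; suc; _≤_)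
open import Data.Bool using (Bool; true; false; if_then_else_)
open import Data.Fin using (Fin)
open import Data.Fin.Subset using (Subset; ∣_∣; _∈_)
open import Data.List using (List; []; _∷_)
open import Data.Vec using (lookup)
open import Data.Product using (Σ; ∃; _×_; _,_)
open import Relation.Binary.PropositionalEquality using (_≡_)

record Graph : Set where
  field
    n      : ℕ
    adj    : Fin n → Fin n → Bool
    sym    : ∀ u v → adj u v ≡ adj v u
    irrefl : ∀ u → adj u u ≡ false
open Graph public

Adj : (G : Graph) → Fin (n G) → Fin (n G) → Set
Adj G u v = adj G u v ≡ true

data Walk (G : Graph) : Fin (n G) → Fin (n G) → ℕ → Set where
  []   : ∀ {u} → Walk G u u zero
  step : ∀ {u w ℓ} (v : Fin (n G)) → Adj G u v → Walk G v w ℓ → Walk G u w (suc ℓ)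

ShortestPath : (G : Graph) → Fin (n G) → Fin (n G) → ℕ → Set
ShortestPath G u v ℓ = Walk G u v ℓ × (∀ ℓ' → Walk G u v ℓ' → ℓ ≤ ℓ')

Connected : Graph → Set
Connected G = ∀ u v → ∃ λ ℓ → Walk G u v ℓ

-- internal vertices of a walk (all vertices except the first and the last)
innerFrom : ∀ {G v w ℓ} → Fin (n G) → Walk G v w ℓ → List (Fin (n G))
innerFrom x []             = []
innerFrom x (step v _ p)   = x ∷ innerFrom v p

inner : ∀ {G u w ℓ} → Walk G u w ℓ → List (Fin (n G))
inner []           = []
inner (step v _ p) = innerFrom v p

countIn : ∀ {m} → Subset m → List (Fin m) → ℕ
countIn X []       = 0
countIn X (x ∷ xs) = if lookup X x then suc (countIn X xs) else countIn X xs

Visible : (F : Graph) → Subset (n F) → ℕ → Fin (n F) → Fin (n F) → Set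
Visible F X k u v =
  Σ ℕ λ ℓ → Σ (ShortestPath F u v ℓ) λ sp →
    countIn X (inner (Data.Product.proj₁ sp)) ≤ k

MutualVisible : (F : Graph) → ℕ → Subset (n F) → Set
MutualVisible F k X = ∀ u v → u ∈ X → v ∈ X → (u ≡ v → Data.Empty.⊥) → Visible F X k u v
  where import Data.Empty

IsMu : (F : Graph) → ℕ → ℕ → Set
IsMu F k m =
  (Σ (Subset (n F)) λ X → MutualVisible F k X × ∣ X ∣ ≡ m) ×
  (∀ X → MutualVisible F k X → ∣ X ∣ ≤ m)

-- A subgraph H of G, given (up to isomorphism) by an injective vertex map
-- that sends edges of H to edges of G.
record Subgraph (G : Graph) : Set where
  field
    H   : Graph
    f   : Fin (n H) → Fin (n G)
    inj : ∀ a b → f a ≡ f b → a ≡ b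
    hom : ∀ a b → Adj H a b → Adj G (f a) (f b)
open Subgraph public

mapWalk : ∀ {G} (S : Subgraph G) {a b ℓ} → Walk (H S) a b ℓ → Walk G (f S a) (f S b) ℓ
mapWalk S []               = []
mapWalk S (step {u} v e p) = step (f S v) (hom S u v e) (mapWalk S p)

-- H is convex in G: every shortest G-path between vertices of H lies entirely
-- in H (all its vertices and edges), i.e. is the image of a walk in H.
Convex : ∀ {G} → Subgraph G → Set
Convex {G} S = ∀ a b ℓ (p : Walk G (f S a) (f S b) ℓ) →
  (∀ ℓ' → Walk G (f S a) (f S b) ℓ' → ℓ ≤ ℓ') →
  Σ (Walk (H S) a b ℓ) λ q → mapWalk S q ≡ p

{-# OPTIONS --safe #-}
module Submission where

-- The image of a mutual k-visible set X of H is a set of the same size in G,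
-- and it is again mutual k-visible: a shortest H-path witnessing the visibility
-- of two vertices of X stays shortest in G, because by convexity every shortest
-- G-path between them is the image of an H-walk of the same length, and mapping
-- it into G preserves which internal vertices lie in the set.

open import Defs
open import Data.Nat using (ℕ; zero; suc; _≤_; _<_)
open import Data.Nat.Induction using (<-rec)
open import Data.Nat.Properties using (anyUpTo?; ≮⇒≥; ≤-trans)
open import Data.Bool using (true)
open import Data.Bool.Properties using () renaming (_≟_ to _≟ᵇ_)
open import Data.Fin using (Fin; zero; suc)
open import Data.Fin.Properties using (any?; suc-injective; 0≢1+n) renaming (_≟_ to _≟ᶠ_)
open import Data.Fin.Subset using (Subset; ∣_∣; _∈_; _∉_; ⊥; inside; outside)
open import Data.Fin.Subset.Properties using (∉⊥; ∣⊥∣≡0; drop-not-there)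
open import Data.Vec using (_∷_; []; lookup; _[_]≔_; here; there)
open import Data.Vec.Properties using ([]=⇒lookup; lookup⇒[]=; lookup∘update; lookup∘update′)
open import Data.List using (_∷_; []; map)
open import Data.Product using (∃; _×_; _,_; proj₁)
open import Function using (_∘_)
open import Function.Definitions using (Injective)
open import Relation.Nullary using (yes; no; contradiction)
open import Relation.Nullary.Decidable using (map′; _×-dec_)
open import Relation.Unary using (Pred; Decidable)
open import Relation.Binary.PropositionalEquality as ≡ using (_≡_; _≢_; refl; trans; cong; subst)

module _ {p} {P : Pred ℕ p} (P? : Decidable P) where

  private
    Least : Set p
    Least = ∃ λ m → P m × (∀ m′ → P m′ → m ≤ m′)

  least-witness : ∀ {n} → P n → Least
  least-witness {n} = <-rec (λ n → P n → Least) search n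
    where
    search : ∀ n → (∀ {m} → m < n → P m → Least) → P n → Least
    search n rec Pn with anyUpTo? P? n
    ... | yes (m , m<n , Pm) = rec m<n Pm
    ... | no none            = n , Pn , λ m′ Pm′ → ≮⇒≥ (λ m′<n → none (m′ , m′<n , Pm′))

∣p[x]≔inside∣≡1+∣p∣ : ∀ {n} {x : Fin n} {p : Subset n} → x ∉ p → ∣ p [ x ]≔ inside ∣ ≡ suc ∣ p ∣
∣p[x]≔inside∣≡1+∣p∣ {x = zero}  {inside  ∷ p} x∉p = contradiction here x∉p
∣p[x]≔inside∣≡1+∣p∣ {x = zero}  {outside ∷ p} x∉p = refl
∣p[x]≔inside∣≡1+∣p∣ {x = suc x} {inside  ∷ p} x∉p = cong suc (∣p[x]≔inside∣≡1+∣p∣ (drop-not-there x∉p))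
∣p[x]≔inside∣≡1+∣p∣ {x = suc x} {outside ∷ p} x∉p = ∣p[x]≔inside∣≡1+∣p∣ (drop-not-there x∉p)

∈-[]≔⁻ : ∀ {n} {p : Subset n} {x w s} → w ≢ x → w ∈ p [ x ]≔ s → w ∈ p
∈-[]≔⁻ {p = p} {s = s} w≢x w∈ = lookup⇒[]= _ p (trans (≡.sym (lookup∘update′ w≢x p s)) ([]=⇒lookup w∈))

image : ∀ {m n} → (Fin m → Fin n) → Subset m → Subset n
image f []            = ⊥
image f (inside ∷ X)  = image (f ∘ suc) X [ f zero ]≔ inside
image f (outside ∷ X) = image (f ∘ suc) X

∈-image⁻ : ∀ {m n} (f : Fin m → Fin n) X {w} → w ∈ image f X → ∃ λ a → a ∈ X × f a ≡ w
∈-image⁻ f []            w∈fX = contradiction w∈fX ∉⊥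
∈-image⁻ f (inside ∷ X) {w} w∈fX with w ≟ᶠ f zero
... | yes refl = zero , here , refl
... | no w≢f0 with ∈-image⁻ (f ∘ suc) X (∈-[]≔⁻ w≢f0 w∈fX)
...   | a , a∈X , refl = suc a , there a∈X , refl
∈-image⁻ f (outside ∷ X) w∈fX with ∈-image⁻ (f ∘ suc) X w∈fX
... | a , a∈X , refl = suc a , there a∈X , refl

f-zero∉image-f∘suc : ∀ {m n} {f : Fin (suc m) → Fin n} → Injective _≡_ _≡_ f →
                     ∀ X → f zero ∉ image (f ∘ suc) X
f-zero∉image-f∘suc {f = f} f-inj X f0∈ with ∈-image⁻ (f ∘ suc) X f0∈
... | _ , _ , f1+a≡f0 = 0≢1+n (f-inj (≡.sym f1+a≡f0))

∣image∣≡∣X∣ : ∀ {m n} {f : Fin m → Fin n} → Injective _≡_ _≡_ f → ∀ X → ∣ image f X ∣ ≡ ∣ X ∣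
∣image∣≡∣X∣ {n = n} f-inj []    = ∣⊥∣≡0 n
∣image∣≡∣X∣ f-inj (inside ∷ X)  =
  trans (∣p[x]≔inside∣≡1+∣p∣ (f-zero∉image-f∘suc f-inj X)) (cong suc (∣image∣≡∣X∣ (suc-injective ∘ f-inj) X))
∣image∣≡∣X∣ f-inj (outside ∷ X) = ∣image∣≡∣X∣ (suc-injective ∘ f-inj) X

lookup-image : ∀ {m n} {f : Fin m → Fin n} → Injective _≡_ _≡_ f →
               ∀ X a → lookup (image f X) (f a) ≡ lookup X a
lookup-image {f = f} f-inj (inside ∷ X) zero = lookup∘update (f zero) (image (f ∘ suc) X) inside
lookup-image {f = f} f-inj (inside ∷ X) (suc a) =
  trans (lookup∘update′ (0≢1+n ∘ ≡.sym ∘ f-inj) (image (f ∘ suc) X) inside)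
        (lookup-image (suc-injective ∘ f-inj) X a)
lookup-image {f = f} f-inj (outside ∷ X) zero with lookup (image (f ∘ suc) X) (f zero) in eq
... | outside = refl
... | inside  = contradiction (lookup⇒[]= _ _ eq) (f-zero∉image-f∘suc f-inj X)
lookup-image f-inj (outside ∷ X) (suc a) = lookup-image (suc-injective ∘ f-inj) X a

countIn-map : ∀ {m n} (g : Fin m → Fin n) {X : Subset m} {Y : Subset n} →
              (∀ a → lookup Y (g a) ≡ lookup X a) → ∀ xs → countIn Y (map g xs) ≡ countIn X xs
countIn-map g Y∘g≗X []       = refl
countIn-map g {X} Y∘g≗X (x ∷ xs) rewrite Y∘g≗X x with lookup X x
... | inside  = cong suc (countIn-map g Y∘g≗X xs)
... | outside = countIn-map g Y∘g≗X xs

walk? : ∀ G u v → Decidable (Walk G u v)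
walk? G u v zero with u ≟ᶠ v
... | yes refl = yes []
... | no u≢v   = no λ { [] → u≢v refl }
walk? G u v (suc ℓ) =
  map′ (λ (w , uw , p) → step w uw p) (λ { (step w uw p) → w , uw , p })
       (any? λ w → (adj G u w ≟ᵇ true) ×-dec walk? G w v ℓ)

shortestPath-from-walk : ∀ {G u v ℓ} → Walk G u v ℓ → ∃ λ m → ShortestPath G u v m
shortestPath-from-walk {G} {u} {v} = least-witness (walk? G u v)

module _ {G : Graph} (S : Subgraph G) where

  f-injective : Injective _≡_ _≡_ (f S)
  f-injective = inj S _ _

  innerFrom-mapWalk : ∀ {a b ℓ} x (q : Walk (H S) a b ℓ) →
                      innerFrom (f S x) (mapWalk S q) ≡ map (f S) (innerFrom x q)
  innerFrom-mapWalk x []           = refl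
  innerFrom-mapWalk x (step v _ q) = cong (f S x ∷_) (innerFrom-mapWalk v q)

  inner-mapWalk : ∀ {a b ℓ} (q : Walk (H S) a b ℓ) → inner (mapWalk S q) ≡ map (f S) (inner q)
  inner-mapWalk []           = refl
  inner-mapWalk (step v _ q) = innerFrom-mapWalk v q

  countIn-image-inner-mapWalk : ∀ X {a b ℓ} (q : Walk (H S) a b ℓ) →
                                countIn (image (f S) X) (inner (mapWalk S q)) ≡ countIn X (inner q)
  countIn-image-inner-mapWalk X q = begin
    countIn (image (f S) X) (inner (mapWalk S q))  ≡⟨ cong (countIn _) (inner-mapWalk q) ⟩
    countIn (image (f S) X) (map (f S) (inner q))  ≡⟨ countIn-map (f S) (lookup-image f-injective X) (inner q) ⟩
    countIn X (inner q)                            ∎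
    where open ≡.≡-Reasoning

  convex⇒mapWalk-shortest : Convex S → ∀ {a b ℓ} → ShortestPath (H S) a b ℓ →
                            ShortestPath G (f S a) (f S b) ℓ
  convex⇒mapWalk-shortest convex {a} {b} {ℓ} (q , q-min) = mapWalk S q , mapWalk-min
    where
    mapWalk-min : ∀ ℓ′ → Walk G (f S a) (f S b) ℓ′ → ℓ ≤ ℓ′
    mapWalk-min ℓ′ p with shortestPath-from-walk p
    ... | m , (p′ , p′-min) = ≤-trans (q-min m (proj₁ (convex a b m p′ p′-min))) (p′-min ℓ′ p)

  convex⇒mutualVisible-image : Convex S → ∀ {k X} → MutualVisible (H S) k X →
                               MutualVisible G k (image (f S) X)
  convex⇒mutualVisible-image convex {k} {X} visible u v u∈Y v∈Y u≢v
    with ∈-image⁻ (f S) X u∈Y | ∈-image⁻ (f S) X v∈Y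
  ... | a , a∈X , refl | b , b∈X , refl
    with visible a b a∈X b∈X (u≢v ∘ cong (f S))
  ... | ℓ , sp@(q , _) , count≤k =
    ℓ , convex⇒mapWalk-shortest convex sp ,
    subst (_≤ k) (≡.sym (countIn-image-inner-mapWalk X q)) count≤k

proposition3p4 : (G : Graph) → Connected G → (k : ℕ) → (S : Subgraph G) → Convex S →
    (a b : ℕ) → IsMu (H S) k a → IsMu G k b → a ≤ b
proposition3p4 G _ k S convex a b ((X , X-visible , ∣X∣≡a) , _) (_ , G-maximum) =
  subst (_≤ b) (trans (∣image∣≡∣X∣ (f-injective S) X) ∣X∣≡a)
        (G-maximum (image (f S) X) (convex⇒mutualVisible-image S convex X-visible))
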